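{- Let $\phi$ be a quantified boolean combination of test formulae, and let $\mathfrak U$ be a universe and $\mathfrak s$ a store. Then: 1. If $(\mathfrak U,\mathfrak s,\mathfrak h)\models\phi$ for some heap $\mathfrak h$, then $(\mathfrak U,\mathfrak s,\mathfrak i)\models\tau(\phi)\wedge\mathrm{Ax}(\phi)$ for some interpretation $\mathfrak i$. 2. Suppose every test formula of the form $|h|\ge|U|-n$ in $\phi$ occurs at negative polarity. If $(\mathfrak U,\mathfrak s,\mathfrak i)\models\tau(\phi)\wedge\mathrm{Ax}(\phi)$ for an interpretation $\mathfrak i$ such that $\mathfrak p^{\mathfrak i}$ is true on only finitely many tuples, then $(\mathfrak U,\mathfrak s,\mathfrak h)\models\phi$ for some heap $\mathfrak h$.
   Context: Fix $k\ge1$. An $\mathsf{SL}^k$-structure is a triple $(\mathfrak U,\mathfrak s,\mathfrak h)$ consisting of a nonempty countable universe $\mathfrak U$, a store $\mathfrak s$ of variables into $\mathfrak U$, and a finite partial heap $\mathfrak h:\mathfrak U\rightharpoonup\mathfrak U^k$. Test formulae are $x\approx y$, $x\hookrightarrow(y_1,\dots,y_k)$, $\mathsf{alloc}(x)$, $|h|\ge n$ ($n\in\mathbb N\cup\{\infty\}$), $|U|\ge n$ ($n\in\mathbb N$) and $|h|\ge|U|-n$ ($n\in\mathbb N$). Their meaning is: - $x\hookrightarrow\vec y$ holds iff $\mathfrak h(\mathfrak s(x))=\mathfrak s(\vec y)$; - $\mathsf{alloc}(x)$ holds iff $\mathfrak s(x)\in\mathrm{dom}(\mathfrak h)$; - $|h|\ge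 n$ holds iff $\mathrm{card}(\mathrm{dom}\,\mathfrak h)\ge n$, and is false for $n=\infty$; - $|U|\ge n$ holds iff $\mathrm{card}(\mathfrak U)\ge n$; - $|h|\ge|U|-n$ holds iff $\mathrm{card}(\mathrm{dom}\,\mathfrak h)\ge\mathrm{card}(\mathfrak U)-n$, with $\infty-n=\infty$. A quantified boolean combination of test formulae is built from test formulae with $\wedge,\neg,\exists$. An occurrence is at positive (negative) polarity if it lies under an even (odd) number of negations. The translation $\tau$ into first-order logic uses a boolean $(k+1)$-ary symbol $\mathfrak p$ and boolean constants $\mathfrak a_n,\mathfrak b_n,\mathfrak c_n$ ($n\in\mathbb N$). It is defined by: - $\tau(|h|\ge n)=\mathfrak a_n$; - $\tau(|U|\ge n)=\mathfrak b_n$; - $\tau(|h|\ge|U|-n)=\neg\mathfrak c_{n+1}$; - $\tau(x\hookrightarrow\vec y)=\mathfrak p(x,\vec y)$; - $\tau(\mathsf{alloc}(x))=\exists y_1\dots\exists y_k.\mathfrak p(x,y_1,\dots,y_k)$; - $\tau(x\approx y)=x\approx y$; - $\tau$ commutes with $\wedge$, $\neg$ and $\exists x$. Let $N$ be the maximum integer parameter $n$ occurring in a test formula $|h|\ge n$, $|U|\ge n$ or $|h|\ge|U|-n$ of $\phi$. With location constants $\mathfrak u_n,\mathfrak v_n,\mathfrak w_n$ ($n>0$), $\mathrm{Ax}(\phi)$ is the conjunction of $P$, of $A_0,\dots,A_N$, of $B_0,\dots,B_N$, and of $C_0,\dots,C_{N+1}$, where: - $P$: $\forall x\forall\vec y\forall\vec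 y'.\mathfrak p(x,\vec y)\wedge\mathfrak p(x,\vec y')\to\bigwedge_{i=1}^k y_i\approx y_i'$. - $A_0=\mathfrak a_0$, $B_0=\mathfrak b_0$, $C_0=\mathfrak c_0$. - $A_n$ ($n>0$): $\big(\exists\vec y.\,\mathfrak a_n\to\mathfrak a_{n-1}\wedge\mathfrak p(\mathfrak u_n,\vec y)\wedge\bigwedge_{i=1}^{n-1}\neg\mathfrak u_i\approx\mathfrak u_n\big)\wedge\forall x\forall\vec y.\,\neg\mathfrak a_n\wedge\mathfrak p(x,\vec y)\to\bigvee_{i=1}^{n-1}x\approx\mathfrak u_i$. - $B_n$ ($n>0$): $\big(\mathfrak b_n\to\mathfrak b_{n-1}\wedge\bigwedge_{i=1}^{n-1}\neg\mathfrak v_i\approx\mathfrak v_n\big)\wedge\forall x.\,\neg\mathfrak b_n\to\bigvee_{i=1}^{n-1}x\approx\mathfrak v_i$. - $C_n$ ($n>0$): $\forall\vec y.\,\mathfrak c_n\to\mathfrak c_{n-1}\wedge\neg\mathfrak p(\mathfrak w_n,\vec y)\wedge\bigwedge_{i=1}^{n-1}\neg\mathfrak w_n\approx\mathfrak w_i$. An interpretation $\mathfrak i$ interprets these symbols over $\mathfrak U$. -}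

module Defs where

open import Data.Nat using (ℕ; zero; suc; _+_; _∸_; _≤_; _⊔_; _≟_)
open import Data.Fin using (Fin; toℕ)
open import Data.Bool using (Bool; true; false; if_then_else_)
open import Data.Vec using (Vec; []; _∷_; map; tabulate; zipWith; toList)
open import Data.List using (List; []; _∷_; length; upTo)
import Data.List as L
open import Data.List.Membership.Propositional using (_∈_)
open import Data.List.Relation.Unary.AllPairs using (AllPairs)
open import Data.List.Relation.Unary.Any using (Any)
open import Data.Product using (Σ; _×_; _,_; proj₁)
open import Data.Sum using (_⊎_)
open import Data.Empty using (⊥)
open import Data.Unit using (⊤)
open import Relation.Nullary using (¬_; does)
open import Relation.Binary.PropositionalEquality using (_≡_; _≢_)

data ℕ∞ : Set where
  fin : ℕ → ℕ∞
  ∞   : ℕ∞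

_≤∞_ : ℕ∞ → ℕ∞ → Set
fin m ≤∞ fin n = m ≤ n
fin m ≤∞ ∞     = ⊤
∞     ≤∞ fin n = ⊥
∞     ≤∞ ∞     = ⊤

_∸∞_ : ℕ∞ → ℕ → ℕ∞
fin m ∸∞ n = fin (m ∸ n)
∞     ∸∞ n = ∞

-- Nonempty countable universes, up to isomorphism:
-- a finite set of size m+1 (Fin (suc m)) or a countably infinite set (ℕ).

data Universe : Set where
  finU : ℕ → Universe
  infU : Universe

Loc : Universe → Set
Loc (finU m) = Fin (suc m)
Loc infU     = ℕ

card : Universe → ℕ∞
card (finU m) = fin (suc m)
card infU     = ∞

Var : Set
Var = ℕ

Store : Universe → Set
Store U = Var → Loc U

_[_↦_] : ∀ {U} → Store U → Var → Loc U → Store U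
(s [ x ↦ ℓ ]) y = if does (y ≟ x) then ℓ else s y

-- Finite partial heaps U ⇀ U^k, as a finite list of cells with
-- pairwise distinct addresses: h(ℓ) = v  iff  (ℓ , v) ∈ cells.

record Heap (k : ℕ) (U : Universe) : Set where
  field
    cells      : List (Loc U × Vec (Loc U) k)
    functional : AllPairs (λ c d → proj₁ c ≢ proj₁ d) cells
open Heap public

domSize : ∀ {k U} → Heap k U → ℕ
domSize h = length (cells h)

data QBC (k : ℕ) : Set where
  _≈_   : Var → Var → QBC k
  _↪_   : Var → Vec Var k → QBC k
  alloc : Var → QBC k
  hGe   : ℕ∞ → QBC k
  uGe   : ℕ → QBC k
  hGeU  : ℕ → QBC k
  and   : QBC k → QBC k → QBC k
  neg   : QBC k → QBC k
  ex    : Var → QBC k → QBC k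

sat : ∀ {k U} → Store U → Heap k U → QBC k → Set
sat s h (x ≈ y)   = s x ≡ s y
sat s h (x ↪ ys)  = (s x , map s ys) ∈ cells h
sat s h (alloc x) = Any (λ c → proj₁ c ≡ s x) (cells h)
sat s h (hGe n)   = n ≤∞ fin (domSize h)
sat {U = U} s h (uGe n)  = fin n ≤∞ card U
sat {U = U} s h (hGeU n) = (card U ∸∞ n) ≤∞ fin (domSize h)
sat s h (and φ ψ) = sat s h φ × sat s h ψ
sat s h (neg φ)   = ¬ sat s h φ
sat {U = U} s h (ex x φ) = Σ (Loc U) λ ℓ → sat (s [ x ↦ ℓ ]) h φ

data Pol : Set where
  pos negv : Pol

flipP : Pol → Pol
flipP pos  = negv
flipP negv = pos

HGeUAt : ∀ {k} → Pol → QBC k → Set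
HGeUAt pos  (hGeU n) = ⊥
HGeUAt negv (hGeU n) = ⊤
HGeUAt p (and φ ψ)   = HGeUAt p φ × HGeUAt p ψ
HGeUAt p (neg φ)     = HGeUAt (flipP p) φ
HGeUAt p (ex x φ)    = HGeUAt p φ
HGeUAt p _           = ⊤

HGeUNegOnly : ∀ {k} → QBC k → Set
HGeUNegOnly φ = HGeUAt pos φ

-- maximal integer parameter N (∞ is not an integer parameter; 0 if none)
maxParam : ∀ {k} → QBC k → ℕ
maxParam (hGe (fin n)) = n
maxParam (uGe n)       = n
maxParam (hGeU n)      = n
maxParam (and φ ψ)     = maxParam φ ⊔ maxParam ψ
maxParam (neg φ)       = maxParam φ
maxParam (ex x φ)      = maxParam φ
maxParam _             = 0

data Term : Set where
  var : Var → Term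
  𝔲 𝔳 𝔴 : ℕ → Term

data FO (k : ℕ) : Set where
  ⊤ᶠ   : FO k
  _≐_  : Term → Term → FO k
  𝔭    : Term → Vec Term k → FO k
  𝔞 𝔟 𝔠 : ℕ → FO k
  andF : FO k → FO k → FO k
  orF  : FO k → FO k → FO k
  impF : FO k → FO k → FO k
  negF : FO k → FO k
  exF  : Var → FO k → FO k
  allF : Var → FO k → FO k

record Interp (k : ℕ) (U : Universe) : Set where
  field
    p     : Loc U → Vec (Loc U) k → Bool
    a b c : ℕ → Bool
    u v w : ℕ → Loc U
open Interp public

evalT : ∀ {k U} → Store U → Interp k U → Term → Loc U
evalT s i (var x) = s x
evalT s i (𝔲 n)   = u i n
evalT s i (𝔳 n)   = v i n
evalT s i (𝔴 n)   = w i n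

satFO : ∀ {k U} → Store U → Interp k U → FO k → Set
satFO s i ⊤ᶠ         = ⊤
satFO s i (t ≐ t')   = evalT s i t ≡ evalT s i t'
satFO s i (𝔭 t ts)   = p i (evalT s i t) (map (evalT s i) ts) ≡ true
satFO s i (𝔞 n)      = a i n ≡ true
satFO s i (𝔟 n)      = b i n ≡ true
satFO s i (𝔠 n)      = c i n ≡ true
satFO s i (andF F G) = satFO s i F × satFO s i G
satFO s i (orF F G)  = satFO s i F ⊎ satFO s i G
satFO s i (impF F G) = satFO s i F → satFO s i G
satFO s i (negF F)   = ¬ satFO s i F
satFO {U = U} s i (exF x F)  = Σ (Loc U) λ ℓ → satFO (s [ x ↦ ℓ ]) i F
satFO {U = U} s i (allF x F) = (ℓ : Loc U) → satFO (s [ x ↦ ℓ ]) i F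

exsV : ∀ {k m} → Vec Var m → FO k → FO k
exsV []       F = F
exsV (x ∷ xs) F = exF x (exsV xs F)

allsV : ∀ {k m} → Vec Var m → FO k → FO k
allsV []       F = F
allsV (x ∷ xs) F = allF x (allsV xs F)

conjL : ∀ {k} → List (FO k) → FO k
conjL []      = ⊤ᶠ
conjL (F ∷ l) = andF F (conjL l)

disjL : ∀ {k} → List (FO k) → FO k
disjL []      = negF ⊤ᶠ
disjL (F ∷ l) = orF F (disjL l)

-- fresh variables y₁ … y_k (all distinct from x) for τ(alloc x)
freshYs : ∀ {k} → Var → Vec Var k
freshYs x = tabulate (λ i → suc (x + toℕ i))

τ : ∀ {k} → QBC k → FO k
τ (x ≈ y)       = var x ≐ var y
τ (x ↪ ys)      = 𝔭 (var x) (map var ys)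
τ {k} (alloc x) = exsV (freshYs {k} x) (𝔭 (var x) (map var (freshYs x)))
τ (hGe (fin n)) = 𝔞 n
τ (hGe ∞)       = negF ⊤ᶠ          -- |h| ≥ ∞ is always false
τ (uGe n)       = 𝔟 n
τ (hGeU n)      = negF (𝔠 (suc n))
τ (and φ ψ)     = andF (τ φ) (τ ψ)
τ (neg φ)       = negF (τ φ)
τ (ex x φ)      = exF x (τ φ)

-- The axioms Ax(φ)   (closed formulae; bound variables x = 0,
-- ȳ = 1 … k, ȳ' = k+1 … 2k)

xV : Term
xV = var 0

ysV : ∀ k → Vec Var k
ysV k = tabulate (λ i → suc (toℕ i))

ys'V : ∀ k → Vec Var k
ys'V k = tabulate (λ i → suc (k + toℕ i))

-- the list 1 , … , m   (i.e. i = 1 … n-1 for n = m+1)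
range : ℕ → List ℕ
range m = L.map suc (upTo m)

AxP : ∀ k → FO k
AxP k = allF 0 (allsV (ysV k) (allsV (ys'V k)
          (impF (andF (𝔭 xV (map var (ysV k))) (𝔭 xV (map var (ys'V k))))
                (conjL (toList (zipWith (λ y y' → var y ≐ var y') (ysV k) (ys'V k)))))))

AxA : ∀ k → ℕ → FO k
AxA k zero    = 𝔞 0
AxA k (suc m) =
  andF (exsV (ysV k) (impF (𝔞 (suc m))
          (andF (𝔞 m) (andF (𝔭 (𝔲 (suc m)) (map var (ysV k)))
             (conjL (L.map (λ i → negF (𝔲 i ≐ 𝔲 (suc m))) (range m)))))))
       (allF 0 (allsV (ysV k) (impF (andF (negF (𝔞 (suc m))) (𝔭 xV (map var (ysV k))))
          (disjL (L.map (λ i → xV ≐ 𝔲 i) (range m))))))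

AxB : ∀ k → ℕ → FO k
AxB k zero    = 𝔟 0
AxB k (suc m) =
  andF (impF (𝔟 (suc m))
          (andF (𝔟 m) (conjL (L.map (λ i → negF (𝔳 i ≐ 𝔳 (suc m))) (range m)))))
       (allF 0 (impF (negF (𝔟 (suc m)))
          (disjL (L.map (λ i → xV ≐ 𝔳 i) (range m)))))

AxC : ∀ k → ℕ → FO k
AxC k zero    = 𝔠 0
AxC k (suc m) =
  allsV (ysV k) (impF (𝔠 (suc m))
    (andF (𝔠 m) (andF (negF (𝔭 (𝔴 (suc m)) (map var (ysV k))))
       (conjL (L.map (λ i → negF (𝔴 (suc m) ≐ 𝔴 i)) (range m))))))

Ax : ∀ {k} → QBC k → FO k
Ax {k} φ = andF (AxP k)
            (andF (conjL (L.map (AxA k) (upTo (suc N))))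
            (andF (conjL (L.map (AxB k) (upTo (suc N))))
                  (conjL (L.map (AxC k) (upTo (suc (suc N)))))))
  where N = maxParam φ

FinitelyTrue : ∀ {k U} → Interp k U → Set
FinitelyTrue {k} {U} i =
  Σ (List (Loc U × Vec (Loc U) k)) λ L →
    ∀ x ys → p i x ys ≡ true → (x , ys) ∈ L

{-# OPTIONS --safe #-}
-- From a heap h, build the canonical interpretation: 𝔭 is the graph of h, the flags 𝔞ₙ, 𝔟ₙ, 𝔠ₙ
-- say |h| ≥ n, |U| ≥ n and |U ∖ dom h| ≥ n, and 𝔲, 𝔳, 𝔴 enumerate dom h, U and U ∖ dom h
-- (for infinite U: ℕ itself, and the numbers above max (dom h)). Every test formula is then
-- translated exactly and Ax(φ) holds, which gives part 1.
--
-- Conversely, a functional, finitely true 𝔭 is the graph of a heap h. Up to N the axioms pin the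
-- flags down: 𝔞ₙ yields n distinct allocated 𝔲's while ¬𝔞ₙ₊₁ confines dom h to 𝔲₁ … 𝔲ₙ, and
-- likewise for 𝔟 and U. The axioms C only work one way: 𝔠ₙ₊₁ yields n + 1 distinct unallocated
-- 𝔴's, refuting |h| ≥ |U| − n, whereas ¬𝔠ₙ₊₁ says nothing. So, by induction with polarity,
-- τ φ implies φ as long as |h| ≥ |U| − n occurs only negatively, which gives part 2.

module Submission where

open import Defs
open import Data.Nat using (ℕ; zero; suc; _+_; _∸_; _≤_; _<_; _≤?_; _≟_; z≤n; s≤s; s≤s⁻¹; z<s)
open import Data.Nat.Properties
open import Data.Fin using (Fin; toℕ)
import Data.Fin.Properties as Finₚ
open import Data.Bool using (Bool; true; if_then_else_)
import Data.Bool.Properties as Boolₚ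
open import Data.Vec using (Vec; []; _∷_; map; tabulate; toList; zipWith; replicate)
import Data.Vec.Properties as Vecₚ
import Data.Product.Properties as Productₚ
open import Data.List using (List; []; _∷_; _++_; length; filter; allFin; applyDownFrom; upTo; deduplicate)
import Data.List as List
import Data.List.Properties as Listₚ
open import Data.List.Extrema.Nat using (max; xs≤max)
import Data.List.Membership.DecPropositional as DecMembership
open import Data.List.Membership.Propositional using (_∈_; _∉_)
open import Data.List.Membership.Propositional.Properties
  using (∈-filter⁺; ∈-filter⁻; ∈-deduplicate⁺; ∈-deduplicate⁻; ∈-allFin; ∈-++⁺ˡ; ∈-++⁺ʳ; ∈-map⁺; ∈-map⁻;
         ∈-applyDownFrom⁺; ∈-applyDownFrom⁻)
open import Data.List.Relation.Binary.Subset.Propositional using (_⊆_)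
open import Data.List.Relation.Unary.All using (All; []; _∷_)
import Data.List.Relation.Unary.All as All
import Data.List.Relation.Unary.All.Properties as Allₚ
open import Data.List.Relation.Unary.Any using (Any; here; there)
import Data.List.Relation.Unary.Any as Any
import Data.List.Relation.Unary.Any.Properties as Anyₚ
open import Data.List.Relation.Unary.AllPairs using (AllPairs; []; _∷_)
import Data.List.Relation.Unary.AllPairs.Properties as AllPairsₚ
open import Data.List.Relation.Unary.Unique.Propositional using (Unique)
import Data.List.Relation.Unary.Unique.Propositional.Properties as Uniqueₚ
import Data.List.Relation.Unary.Unique.DecPropositional.Properties as DecUniqueₚ
open import Data.Product using (Σ; ∃; _×_; _,_; proj₁; proj₂)
open import Data.Sum using (inj₁; inj₂)
open import Data.Empty using (⊥; ⊥-elim)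
open import Data.Unit using (⊤; tt)
open import Function using (_∘_; id)
open import Function.Bundles using (_⇔_; mk⇔; Equivalence)
open import Function.Related.TypeIsomorphisms using (¬-cong-⇔)
open import Data.Product.Function.NonDependent.Propositional using (_×-⇔_)
open import Data.Product.Function.Dependent.Propositional using () renaming (congˡ to Σ-congˡ)
import Function.Properties.Equivalence as ⇔
open import Relation.Nullary using (Dec; yes; no; does; ¬_; ¬?; contradiction)
open import Relation.Nullary.Decidable using (dec-true; dec-false; decidable-stable)
open import Relation.Binary.Definitions using (DecidableEquality)
open import Relation.Binary.PropositionalEquality

open Equivalence using (to; from)

does⇔ : ∀ {A : Set} (a? : Dec A) → does a? ≡ true ⇔ A
does⇔ (yes a) = mk⇔ (λ _ → a) (λ _ → refl)
does⇔ (no ¬a) = mk⇔ (λ ()) (λ a → contradiction a ¬a)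

Unique-⊆⇒length≤ : ∀ {A : Set} → DecidableEquality A → {xs ys : List A} →
                   Unique xs → xs ⊆ ys → length xs ≤ length ys
Unique-⊆⇒length≤ _≟ᴬ_ {[]}     _              _   = z≤n
Unique-⊆⇒length≤ _≟ᴬ_ {x ∷ xs} {ys} (x∉xs ∷ u) xs⊆ys =
  ≤-trans (s≤s (Unique-⊆⇒length≤ _≟ᴬ_ u xs⊆ys-x)) (Listₚ.filter-notAll other? ys x∈ys)
  where
  other? = λ y → ¬? (y ≟ᴬ x)
  x∈ys : Any (λ y → ¬ ¬ y ≡ x) ys
  x∈ys = Any.map (λ y≡x y≢x → y≢x (sym y≡x)) (xs⊆ys (here refl))
  xs⊆ys-x : xs ⊆ filter other? ys
  xs⊆ys-x z∈xs = ∈-filter⁺ other? (xs⊆ys (there z∈xs)) (λ z≡x → All.lookup x∉xs z∈xs (sym z≡x))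

keys-distinct⇒functional : ∀ {A B : Set} {xs : List (A × B)} → AllPairs (λ c d → proj₁ c ≢ proj₁ d) xs →
                           ∀ {x v v′} → (x , v) ∈ xs → (x , v′) ∈ xs → v ≡ v′
keys-distinct⇒functional (_ ∷ _)     (here refl) (here refl) = refl
keys-distinct⇒functional (x∉ ∷ _)    (here refl) (there c∈)  = ⊥-elim (All.lookup x∉ c∈ refl)
keys-distinct⇒functional (x∉ ∷ _)    (there c∈)  (here refl) = ⊥-elim (All.lookup x∉ c∈ refl)
keys-distinct⇒functional (_ ∷ keys) (there c∈)  (there c′∈) = keys-distinct⇒functional keys c∈ c′∈

AllPairs-mapWithAll : ∀ {A : Set} {P : A → Set} {R S : A → A → Set} {xs : List A} →
                      (∀ {x y} → P x → P y → R x y → S x y) → All P xs → AllPairs R xs → AllPairs S xs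
AllPairs-mapWithAll f []        []        = []
AllPairs-mapWithAll f (Px ∷ Ps) (Rx ∷ Rs) =
  All.zipWith (λ (r , Py) → f Px Py r) (Rx , Ps) ∷ AllPairs-mapWithAll f Ps Rs

nth : ∀ {A : Set} → List A → ℕ → A → A
nth []       _       d = d
nth (x ∷ xs) zero    _ = x
nth (x ∷ xs) (suc j) d = nth xs j d

nth-∈ : ∀ {A : Set} (xs : List A) {j} d → j < length xs → nth xs j d ∈ xs
nth-∈ (x ∷ xs) {zero}  d _   = here refl
nth-∈ (x ∷ xs) {suc j} d j<n = there (nth-∈ xs d (s≤s⁻¹ j<n))

∈⇒nth : ∀ {A : Set} {xs : List A} d {x} → x ∈ xs → ∃ λ j → j < length xs × x ≡ nth xs j d
∈⇒nth d (here refl) = 0 , s≤s z≤n , refl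
∈⇒nth d (there x∈)  = let j , j<n , eq = ∈⇒nth d x∈ in suc j , s≤s j<n , eq

AllPairs-nth : ∀ {A : Set} {R : A → A → Set} {xs : List A} d → AllPairs R xs →
               ∀ {i j} → i < j → j < length xs → R (nth xs i d) (nth xs j d)
AllPairs-nth {xs = x ∷ xs} d (Rx ∷ _) {zero}  {suc j} _   j<n = All.lookup Rx (nth-∈ xs d (s≤s⁻¹ j<n))
AllPairs-nth {xs = x ∷ xs} d (_ ∷ R) {suc i} {suc j} i<j j<n = AllPairs-nth d R (s≤s⁻¹ i<j) (s≤s⁻¹ j<n)

module Enumeration {A : Set} (xs : List A) (d : A) where

  flag : ℕ → Bool
  flag n = does (n ≤? length xs)

  -- Constants are numbered from 1; entry 0 is junk.
  entry : ℕ → A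
  entry zero    = d
  entry (suc j) = nth xs j d

  flag⇔ : ∀ {n} → flag n ≡ true ⇔ n ≤ length xs
  flag⇔ {n} = does⇔ (n ≤? length xs)

  flag-pred : ∀ {m} → flag (suc m) ≡ true → flag m ≡ true
  flag-pred f = from flag⇔ (<⇒≤ (to flag⇔ f))

  entry-∈ : ∀ {m} → flag (suc m) ≡ true → entry (suc m) ∈ xs
  entry-∈ f = nth-∈ xs d (to flag⇔ f)

  entry-AllPairs : ∀ {R : A → A → Set} → AllPairs R xs →
                   ∀ {m j} → flag (suc m) ≡ true → j < m → R (entry (suc j)) (entry (suc m))
  entry-AllPairs R f j<m = AllPairs-nth d R j<m (to flag⇔ f)

  entry-covers : ∀ {m x} → ¬ flag (suc m) ≡ true → x ∈ xs → ∃ λ j → j < m × x ≡ entry (suc j)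
  entry-covers ¬f x∈ =
    let j , j<n , eq = ∈⇒nth d x∈ in j , <-≤-trans j<n (≮⇒≥ (¬f ∘ from flag⇔)) , eq

chain : ∀ {A : Set} {P : ℕ → Set} {Q : A → Set} (g : ℕ → A) n →
        (∀ {m} → m < n → P (suc m) → P m × Q (g (suc m)) × (∀ {j} → j < m → g (suc j) ≢ g (suc m))) →
        P n → Unique (applyDownFrom (g ∘ suc) n) × All Q (applyDownFrom (g ∘ suc) n)
chain g zero    step _  = [] , []
chain g (suc n) step Pn =
  let Pn-1 , Qn , distinct = step ≤-refl Pn
      unique , all = chain g n (λ m<n → step (m<n⇒m<1+n m<n)) Pn-1
      fresh : All (g (suc n) ≢_) (applyDownFrom (g ∘ suc) n)
      fresh = All.tabulate λ y∈ eq →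
        let j , j<n , y≡ = ∈-applyDownFrom⁻ (g ∘ suc) y∈ in distinct j<n (sym (trans eq y≡))
  in fresh ∷ unique , Qn ∷ all

∈-applyDownFrom-suc⁺ : ∀ {A : Set} (g : ℕ → A) {m x} → (∃ λ j → j < m × x ≡ g (suc j)) →
                       x ∈ applyDownFrom (g ∘ suc) m
∈-applyDownFrom-suc⁺ g (j , j<m , refl) = ∈-applyDownFrom⁺ (g ∘ suc) j<m

All-range⇔ : ∀ {P : ℕ → Set} m → All P (range m) ⇔ (∀ {j} → j < m → P (suc j))
All-range⇔ {P} m = mk⇔ lookup build
  where
  lookup : All P (range m) → ∀ {j} → j < m → P (suc j)
  lookup h = Allₚ.applyUpTo⁻ {P = P ∘ suc} id m (Allₚ.map⁻ h)
  build : (∀ {j} → j < m → P (suc j)) → All P (range m)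
  build h = Allₚ.map⁺ (Allₚ.applyUpTo⁺₁ {P = P ∘ suc} id m h)

Any-range⇔ : ∀ {P : ℕ → Set} m → Any P (range m) ⇔ (∃ λ j → j < m × P (suc j))
Any-range⇔ {P} m = mk⇔
  (λ h → Anyₚ.applyUpTo⁻ {P = P ∘ suc} id (Anyₚ.map⁻ h))
  (λ (j , j<m , Pj) → Anyₚ.map⁺ (Anyₚ.applyUpTo⁺ {P = P ∘ suc} id Pj j<m))

All-upTo-suc⇔ : ∀ {P : ℕ → Set} n → All P (upTo (suc n)) ⇔ (P 0 × ∀ {m} → m < n → P (suc m))
All-upTo-suc⇔ {P} n = mk⇔ split join
  where
  split : All P (upTo (suc n)) → P 0 × ∀ {m} → m < n → P (suc m)
  split (P0 ∷ Ps) = P0 , Allₚ.applyUpTo⁻ suc n Ps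
  join : P 0 × (∀ {m} → m < n → P (suc m)) → All P (upTo (suc n))
  join (P0 , Ps) = P0 ∷ Allₚ.applyUpTo⁺₁ suc n Ps

_≟ᴸ_ : ∀ {U} → DecidableEquality (Loc U)
_≟ᴸ_ {finU m} = Finₚ._≟_
_≟ᴸ_ {infU}   = _≟_

_≟ᶜ_ : ∀ {k U} → DecidableEquality (Loc U × Vec (Loc U) k)
_≟ᶜ_ = Productₚ.≡-dec _≟ᴸ_ (Vecₚ.≡-dec _≟ᴸ_)

loc₀ : ∀ U → Loc U
loc₀ (finU m) = Fin.zero
loc₀ infU     = 0

fresh∉ : ∀ (xs : List ℕ) j → suc (max 0 xs) + j ∉ xs
fresh∉ xs j x∈ = <⇒≱ (s≤s (m≤m+n _ j)) (All.lookup (xs≤max 0 xs) x∈)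

length-allFin : ∀ n → length (allFin n) ≡ n
length-allFin n = Listₚ.length-tabulate id

length≤card : ∀ {U} {xs : List (Loc U)} → Unique xs → fin (length xs) ≤∞ card U
length≤card {finU m} u =
  ≤-trans (Unique-⊆⇒length≤ _≟ᴸ_ u (λ _ → ∈-allFin _)) (≤-reflexive (length-allFin (suc m)))
length≤card {infU}   _ = tt

card≤length : ∀ {U} {xs : List (Loc U)} → (∀ x → x ∈ xs) → card U ≤∞ fin (length xs)
card≤length {finU m} covers =
  ≤-trans (≤-reflexive (sym (length-allFin (suc m))))
          (Unique-⊆⇒length≤ _≟ᴸ_ (Uniqueₚ.allFin⁺ (suc m)) (λ {x} _ → covers x))
card≤length {infU} {xs} covers = fresh∉ xs 0 (covers _)

≤∞-trans : ∀ {x y z} → x ≤∞ y → y ≤∞ z → x ≤∞ z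
≤∞-trans {fin _} {fin _} {fin _} = ≤-trans
≤∞-trans {fin _} {fin _} {∞}     _ _ = tt
≤∞-trans {fin _} {∞}     {∞}     _ _ = tt
≤∞-trans {∞}     {∞}     {∞}     _ _ = tt

hGeU-refuted : ∀ {U} (xs ys : List (Loc U)) {n} → Unique (xs ++ ys) → n < length xs →
               ¬ (card U ∸∞ n) ≤∞ fin (length ys)
hGeU-refuted {finU m} xs ys {n} unique n<xs hyp = <-irrefl refl (begin-strict
  n + length ys          <⟨ +-monoˡ-< (length ys) n<xs ⟩
  length xs + length ys  ≡⟨ Listₚ.length-++ xs ⟨
  length (xs ++ ys)      ≤⟨ length≤card unique ⟩
  suc m                  ≤⟨ m≤n+m∸n (suc m) n ⟩
  n + (suc m ∸ n)        ≤⟨ +-monoʳ-≤ n hyp ⟩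
  n + length ys          ∎)
  where open ≤-Reasoning
hGeU-refuted {infU} _ _ _ _ ()

hGeU-covered : ∀ {U} (xs ys : List (Loc U)) {n} → (∀ x → x ∈ xs ++ ys) → length xs ≤ n →
               (card U ∸∞ n) ≤∞ fin (length ys)
hGeU-covered {finU m} xs ys {n} covers xs≤n = m≤n+o⇒m∸n≤o (suc m) n (begin
  suc m                  ≤⟨ card≤length covers ⟩
  length (xs ++ ys)      ≡⟨ Listₚ.length-++ xs ⟩
  length xs + length ys  ≤⟨ +-monoˡ-≤ (length ys) xs≤n ⟩
  n + length ys          ∎)
  where open ≤-Reasoning
hGeU-covered {infU} _ _ covers _ = ⊥-elim (card≤length covers)

module _ {m} (xs : List (Fin (suc m))) where

  ∉? : ∀ x → Dec (x ∉ xs)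
  ∉? x = ¬? (DecMembership._∈?_ Finₚ._≟_ x xs)

  complement : List (Fin (suc m))
  complement = filter ∉? (allFin (suc m))

  complement-unique : Unique complement
  complement-unique = Uniqueₚ.filter⁺ ∉? (Uniqueₚ.allFin⁺ (suc m))

  ∈complement⇒∉ : ∀ {x} → x ∈ complement → x ∉ xs
  ∈complement⇒∉ x∈ = proj₂ (∈-filter⁻ ∉? {xs = allFin (suc m)} x∈)

  complement-++-unique : Unique xs → Unique (complement ++ xs)
  complement-++-unique u = Uniqueₚ.++⁺ complement-unique u (λ (x∈ , x∈xs) → ∈complement⇒∉ x∈ x∈xs)

  complement-++-covers : ∀ x → x ∈ complement ++ xs
  complement-++-covers x with DecMembership._∈?_ Finₚ._≟_ x xs
  ... | yes x∈xs = ∈-++⁺ʳ complement x∈xs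
  ... | no  x∉xs = ∈-++⁺ˡ (∈-filter⁺ ∉? (∈-allFin x) x∉xs)

update-same : ∀ {U} (s : Store U) x ℓ → (s [ x ↦ ℓ ]) x ≡ ℓ
update-same s x ℓ = cong (if_then ℓ else s x) (dec-true (x ≟ x) refl)

update-other : ∀ {U} (s : Store U) {x y} ℓ → y ≢ x → (s [ x ↦ ℓ ]) y ≡ s y
update-other s {x} {y} ℓ y≢x = cong (if_then ℓ else s y) (dec-false (y ≟ x) y≢x)

_[_↦*_] : ∀ {U m} → Store U → Vec Var m → Vec (Loc U) m → Store U
s [ []     ↦* []     ] = s
s [ x ∷ xs ↦* v ∷ vs ] = (s [ x ↦ v ]) [ xs ↦* vs ]

consecutive : ℕ → (m : ℕ) → Vec Var m
consecutive c zero    = []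
consecutive c (suc m) = c ∷ consecutive (suc c) m

-- ysV k, ys'V k and freshYs x are definitionally blocks.
block : ℕ → (m : ℕ) → Vec Var m
block c m = tabulate (λ j → c + toℕ j)

block≡consecutive : ∀ c m → block c m ≡ consecutive c m
block≡consecutive c zero    = refl
block≡consecutive c (suc m) =
  cong₂ _∷_ (+-identityʳ c) (trans (Vecₚ.tabulate-cong (λ j → +-suc c (toℕ j))) (block≡consecutive (suc c) m))

module _ {U : Universe} where

  private
    below : ∀ (s : Store U) c {m} vs {y} → y < c → (s [ consecutive c m ↦* vs ]) y ≡ s y
    below s c {zero}  []       y<c = refl
    below s c {suc m} (v ∷ vs) y<c =
      trans (below _ (suc c) vs (m<n⇒m<1+n y<c)) (update-other s v (<⇒≢ y<c))

    inside : ∀ (s : Store U) c {m} vs → map (s [ consecutive c m ↦* vs ]) (consecutive c m) ≡ vs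
    inside s c {zero}  []       = refl
    inside s c {suc m} (v ∷ vs) =
      cong₂ _∷_ (trans (below _ (suc c) vs ≤-refl) (update-same s c v)) (inside _ (suc c) vs)

    map-below : ∀ (s : Store U) c m {d n} ws → c + m ≤ d →
                map (s [ consecutive d n ↦* ws ]) (consecutive c m) ≡ map s (consecutive c m)
    map-below s c zero    ws _     = refl
    map-below s c (suc m) ws c+m≤d =
      cong₂ _∷_ (below s _ ws (<-≤-trans (m<m+n c z<s) c+m≤d))
                (map-below s (suc c) m ws (≤-trans (≤-reflexive (sym (+-suc c m))) c+m≤d))

  update*-below : ∀ (s : Store U) c {m} vs {y} → y < c → (s [ block c m ↦* vs ]) y ≡ s y
  update*-below s c {m} vs y<c rewrite block≡consecutive c m = below s c vs y<c

  map-update* : ∀ (s : Store U) c {m} vs → map (s [ block c m ↦* vs ]) (block c m) ≡ vs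
  map-update* s c {m} vs rewrite block≡consecutive c m = inside s c vs

  map-update*-below : ∀ (s : Store U) c m {d n} ws → c + m ≤ d →
                      map (s [ block d n ↦* ws ]) (block c m) ≡ map s (block c m)
  map-update*-below s c m {d} {n} ws c+m≤d
    rewrite block≡consecutive c m | block≡consecutive d n = map-below s c m ws c+m≤d

-- The meaning of the axioms

module _ {k U} (i : Interp k U) where

  Cell : Loc U → Vec (Loc U) k → Set
  Cell x vs = p i x vs ≡ true

  sat-allsV⇔ : ∀ {m} (s : Store U) (zs : Vec Var m) F →
               satFO s i (allsV zs F) ⇔ (∀ vs → satFO (s [ zs ↦* vs ]) i F)
  sat-allsV⇔ s []       F = mk⇔ (λ { h [] → h }) (λ h → h [])
  sat-allsV⇔ s (z ∷ zs) F = mk⇔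
    (λ { h (v ∷ vs) → to (sat-allsV⇔ _ zs F) (h v) vs })
    (λ h v → from (sat-allsV⇔ _ zs F) (h ∘ (v ∷_)))

  sat-exsV⇔ : ∀ {m} (s : Store U) (zs : Vec Var m) F →
              satFO s i (exsV zs F) ⇔ (∃ λ vs → satFO (s [ zs ↦* vs ]) i F)
  sat-exsV⇔ s []       F = mk⇔ ([] ,_) (λ { ([] , h) → h })
  sat-exsV⇔ s (z ∷ zs) F = mk⇔
    (λ (v , h) → let vs , h′ = to (sat-exsV⇔ _ zs F) h in v ∷ vs , h′)
    (λ { (v ∷ vs , h) → v , from (sat-exsV⇔ _ zs F) (vs , h) })

  sat-conjL⇔ : ∀ {A : Set} (s : Store U) (f : A → FO k) xs →
               satFO s i (conjL (List.map f xs)) ⇔ All (λ x → satFO s i (f x)) xs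
  sat-conjL⇔ s f []       = mk⇔ (λ _ → []) (λ _ → tt)
  sat-conjL⇔ s f (x ∷ xs) = mk⇔
    (λ (h , hs) → h ∷ to (sat-conjL⇔ s f xs) hs)
    (λ { (h ∷ hs) → h , from (sat-conjL⇔ s f xs) hs })

  sat-disjL⇔ : ∀ {A : Set} (s : Store U) (f : A → FO k) xs →
               satFO s i (disjL (List.map f xs)) ⇔ Any (λ x → satFO s i (f x)) xs
  sat-disjL⇔ s f []       = mk⇔ (λ h → ⊥-elim (h tt)) (λ ())
  sat-disjL⇔ s f (x ∷ xs) = mk⇔
    (λ { (inj₁ h) → here h ; (inj₂ h) → there (to (sat-disjL⇔ s f xs) h) })
    (λ { (here h) → inj₁ h ; (there h) → inj₂ (from (sat-disjL⇔ s f xs) h) })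

  sat-𝔭⇔ : ∀ (s : Store U) t (zs : Vec Var k) {x vs} → evalT s i t ≡ x → map s zs ≡ vs →
           satFO s i (𝔭 t (map var zs)) ⇔ Cell x vs
  sat-𝔭⇔ s t zs refl refl = mk⇔ (subst (Cell _) args) (subst (Cell _) (sym args))
    where args = sym (Vecₚ.map-∘ (evalT s i) var zs)

  sat-≐s⇔ : ∀ {m} (s : Store U) (zs zs′ : Vec Var m) →
            satFO s i (conjL (toList (zipWith (λ y y′ → var y ≐ var y′) zs zs′))) ⇔ map s zs ≡ map s zs′
  sat-≐s⇔ s []       []         = mk⇔ (λ _ → refl) (λ _ → tt)
  sat-≐s⇔ s (z ∷ zs) (z′ ∷ zs′) = mk⇔
    (λ (e , es) → cong₂ _∷_ e (to (sat-≐s⇔ s zs zs′) es))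
    (λ e → Vecₚ.∷-injectiveˡ e , from (sat-≐s⇔ s zs zs′) (Vecₚ.∷-injectiveʳ e))

  Allocated : Loc U → Set
  Allocated x = ∃ (Cell x)

  Functional : Set
  Functional = ∀ {x ys ys′} → Cell x ys → Cell x ys′ → ys ≡ ys′

  sat-AxP⇔ : ∀ s → satFO s i (AxP k) ⇔ Functional
  sat-AxP⇔ s = mk⇔ ⇒functional functional⇒
    where
    module Bound (x : Loc U) (ys ys′ : Vec (Loc U) k) where
      s₁ = s [ 0 ↦ x ]
      s₂ = s₁ [ ysV k ↦* ys ]
      s₃ = s₂ [ ys'V k ↦* ys′ ]
      at-x : s₃ 0 ≡ x
      at-x = trans (update*-below s₂ (suc k) ys′ z<s) (update*-below s₁ 1 ys z<s)
      at-ys : map s₃ (ysV k) ≡ ys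
      at-ys = trans (map-update*-below s₂ 1 k ys′ ≤-refl) (map-update* s₁ 1 ys)
      at-ys′ : map s₃ (ys'V k) ≡ ys′
      at-ys′ = map-update* s₂ (suc k) ys′
      cell⇔ : satFO s₃ i (𝔭 xV (map var (ysV k))) ⇔ Cell x ys
      cell⇔ = sat-𝔭⇔ s₃ xV (ysV k) at-x at-ys
      cell′⇔ : satFO s₃ i (𝔭 xV (map var (ys'V k))) ⇔ Cell x ys′
      cell′⇔ = sat-𝔭⇔ s₃ xV (ys'V k) at-x at-ys′
      body⇔ = sat-≐s⇔ s₃ (ysV k) (ys'V k)
    ⇒functional : satFO s i (AxP k) → Functional
    ⇒functional h {x} {ys} {ys′} c c′ = begin
      ys          ≡⟨ at-ys ⟨
      map s₃ _    ≡⟨ to body⇔ (body (from cell⇔ c , from cell′⇔ c′)) ⟩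
      map s₃ _    ≡⟨ at-ys′ ⟩
      ys′         ∎
      where
      open Bound x ys ys′
      open ≡-Reasoning
      body = to (sat-allsV⇔ s₂ (ys'V k) _) (to (sat-allsV⇔ s₁ (ysV k) _) (h x) ys) ys′
    functional⇒ : Functional → satFO s i (AxP k)
    functional⇒ f x = from (sat-allsV⇔ _ (ysV k) _) λ ys → from (sat-allsV⇔ _ (ys'V k) _) λ ys′ (c , c′) →
      let open Bound x ys ys′ in
      from body⇔ (trans at-ys (trans (f (to cell⇔ c) (to cell′⇔ c′)) (sym at-ys′)))

  ⟦AxA⟧ : ℕ → Set
  ⟦AxA⟧ m = (∃ λ vs → a i (suc m) ≡ true →
                a i m ≡ true × Cell (u i (suc m)) vs × (∀ {j} → j < m → u i (suc j) ≢ u i (suc m)))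
          × (∀ x vs → ¬ a i (suc m) ≡ true → Cell x vs → ∃ λ j → j < m × x ≡ u i (suc j))

  ⟦AxB⟧ : ℕ → Set
  ⟦AxB⟧ m = (b i (suc m) ≡ true → b i m ≡ true × (∀ {j} → j < m → v i (suc j) ≢ v i (suc m)))
          × (∀ x → ¬ b i (suc m) ≡ true → ∃ λ j → j < m × x ≡ v i (suc j))

  ⟦AxC⟧ : ℕ → Set
  ⟦AxC⟧ m = ∀ vs → c i (suc m) ≡ true →
              c i m ≡ true × ¬ Cell (w i (suc m)) vs × (∀ {j} → j < m → w i (suc m) ≢ w i (suc j))

  sat-AxA⇔ : ∀ s m → satFO s i (AxA k (suc m)) ⇔ ⟦AxA⟧ m
  sat-AxA⇔ s m = mk⇔ sem syn
    where
    Y = ysV k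
    module _ (x : Loc U) (ys : Vec (Loc U) k) where
      s₂ = (s [ 0 ↦ x ]) [ Y ↦* ys ]
      at-x : s₂ 0 ≡ x
      at-x = update*-below (s [ 0 ↦ x ]) 1 ys z<s
      cell⇔ : satFO s₂ i (𝔭 xV (map var Y)) ⇔ Cell x ys
      cell⇔ = sat-𝔭⇔ s₂ xV Y at-x (map-update* _ 1 ys)
    cellᵘ⇔ : ∀ vs → satFO (s [ Y ↦* vs ]) i (𝔭 (𝔲 (suc m)) (map var Y)) ⇔ Cell (u i (suc m)) vs
    cellᵘ⇔ vs = sat-𝔭⇔ _ (𝔲 (suc m)) Y refl (map-update* s 1 vs)
    sem : satFO s i (AxA k (suc m)) → ⟦AxA⟧ m
    sem (e , d) = (vs , λ a+ → let am , cu , ne = up a+ in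
                     am , to (cellᵘ⇔ vs) cu , to (All-range⇔ m) (to (sat-conjL⇔ _ _ (range m)) ne))
                , λ x ys ¬a c →
                    let j , j<m , eq = to (Any-range⇔ m) (to (sat-disjL⇔ _ _ (range m))
                                         (to (sat-allsV⇔ _ Y _) (d x) ys (¬a , from (cell⇔ x ys) c)))
                    in j , j<m , trans (sym (at-x x ys)) eq
      where
      vs = proj₁ (to (sat-exsV⇔ s Y _) e)
      up = proj₂ (to (sat-exsV⇔ s Y _) e)
    syn : ⟦AxA⟧ m → satFO s i (AxA k (suc m))
    syn ((vs , up) , down) =
        from (sat-exsV⇔ s Y _) (vs , λ a+ → let am , cu , ne = up a+ in
               am , from (cellᵘ⇔ vs) cu , from (sat-conjL⇔ _ _ (range m)) (from (All-range⇔ m) ne))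
      , λ x → from (sat-allsV⇔ _ Y _) λ ys (¬a , c) →
          let j , j<m , eq = down x ys ¬a (to (cell⇔ x ys) c) in
          from (sat-disjL⇔ _ _ (range m)) (from (Any-range⇔ m) (j , j<m , trans (at-x x ys) eq))

  sat-AxB⇔ : ∀ s m → satFO s i (AxB k (suc m)) ⇔ ⟦AxB⟧ m
  sat-AxB⇔ s m = mk⇔
    (λ (up , down) →
        (λ b+ → let bm , ne = up b+ in bm , to (All-range⇔ m) (to (sat-conjL⇔ s _ (range m)) ne))
      , λ x ¬b → to (Any-range⇔ m) (to (sat-disjL⇔ _ _ (range m)) (down x ¬b)))
    (λ (up , down) →
        (λ b+ → let bm , ne = up b+ in bm , from (sat-conjL⇔ s _ (range m)) (from (All-range⇔ m) ne))
      , λ x ¬b → from (sat-disjL⇔ _ _ (range m)) (from (Any-range⇔ m) (down x ¬b)))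

  sat-AxC⇔ : ∀ s m → satFO s i (AxC k (suc m)) ⇔ ⟦AxC⟧ m
  sat-AxC⇔ s m = mk⇔ sem syn
    where
    cellʷ⇔ : ∀ vs → satFO (s [ ysV k ↦* vs ]) i (𝔭 (𝔴 (suc m)) (map var (ysV k))) ⇔ Cell (w i (suc m)) vs
    cellʷ⇔ vs = sat-𝔭⇔ _ (𝔴 (suc m)) (ysV k) refl (map-update* s 1 vs)
    sem : satFO s i (AxC k (suc m)) → ⟦AxC⟧ m
    sem h vs c+ = let cm , ¬cell , ne = to (sat-allsV⇔ s (ysV k) _) h vs c+ in
      cm , ¬cell ∘ from (cellʷ⇔ vs) , to (All-range⇔ m) (to (sat-conjL⇔ _ _ (range m)) ne)
    syn : ⟦AxC⟧ m → satFO s i (AxC k (suc m))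
    syn h = from (sat-allsV⇔ s (ysV k) _) λ vs c+ → let cm , ¬cell , ne = h vs c+ in
      cm , ¬cell ∘ to (cellʷ⇔ vs) , from (sat-conjL⇔ _ _ (range m)) (from (All-range⇔ m) ne)

  record AxiomsUpTo (N : ℕ) : Set where
    field
      p-functional : Functional
      a-zero : a i 0 ≡ true
      a-step : ∀ {m} → m < N → ⟦AxA⟧ m
      b-zero : b i 0 ≡ true
      b-step : ∀ {m} → m < N → ⟦AxB⟧ m
      c-zero : c i 0 ≡ true
      c-step : ∀ {m} → m < suc N → ⟦AxC⟧ m

  sat-Ax⇔ : ∀ s (φ : QBC k) → satFO s i (Ax φ) ⇔ AxiomsUpTo (maxParam φ)
  sat-Ax⇔ s φ = mk⇔ sem syn
    where
    N = maxParam φ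
    family⇔ : ∀ (F : ℕ → FO k) n → satFO s i (conjL (List.map F (upTo (suc n)))) ⇔
              (satFO s i (F 0) × ∀ {m} → m < n → satFO s i (F (suc m)))
    family⇔ F n = mk⇔ (to (All-upTo-suc⇔ n) ∘ to (sat-conjL⇔ s F _))
                      (from (sat-conjL⇔ s F _) ∘ from (All-upTo-suc⇔ n))
    sem : satFO s i (Ax φ) → AxiomsUpTo N
    sem (P , A , B , C) = record
      { p-functional = to (sat-AxP⇔ s) P
      ; a-zero = proj₁ (to (family⇔ (AxA k) N) A)
      ; a-step = to (sat-AxA⇔ s _) ∘ proj₂ (to (family⇔ (AxA k) N) A)
      ; b-zero = proj₁ (to (family⇔ (AxB k) N) B)
      ; b-step = to (sat-AxB⇔ s _) ∘ proj₂ (to (family⇔ (AxB k) N) B)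
      ; c-zero = proj₁ (to (family⇔ (AxC k) (suc N)) C)
      ; c-step = to (sat-AxC⇔ s _) ∘ proj₂ (to (family⇔ (AxC k) (suc N)) C)
      }
    syn : AxiomsUpTo N → satFO s i (Ax φ)
    syn ax = from (sat-AxP⇔ s) p-functional
           , from (family⇔ (AxA k) N) (a-zero , from (sat-AxA⇔ s _) ∘ a-step)
           , from (family⇔ (AxB k) N) (b-zero , from (sat-AxB⇔ s _) ∘ b-step)
           , from (family⇔ (AxC k) (suc N)) (c-zero , from (sat-AxC⇔ s _) ∘ c-step)
      where open AxiomsUpTo ax

  sat-τ-alloc⇔ : ∀ s x → satFO s i (τ (alloc x)) ⇔ Allocated (s x)
  sat-τ-alloc⇔ s x = ⇔.trans (sat-exsV⇔ s F _) (Σ-congˡ (cell⇔ _))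
    where
    F = freshYs {k} x
    cell⇔ : ∀ vs → satFO (s [ F ↦* vs ]) i (𝔭 (var x) (map var F)) ⇔ Cell (s x) vs
    cell⇔ vs = sat-𝔭⇔ _ (var x) F (update*-below s (suc x) vs ≤-refl) (map-update* s (suc x) vs)

dom : ∀ {k U} → Heap k U → List (Loc U)
dom h = List.map proj₁ (cells h)

module _ {k U} (h : Heap k U) where

  dom-unique : Unique (dom h)
  dom-unique = AllPairsₚ.map⁺ (functional h)

  length-dom : length (dom h) ≡ domSize h
  length-dom = Listₚ.length-map proj₁ (cells h)

  sat-alloc⇔ : ∀ s x → sat s h (alloc x) ⇔ s x ∈ dom h
  sat-alloc⇔ s x = mk⇔ (Anyₚ.map⁺ ∘ Any.map sym) (Any.map sym ∘ Anyₚ.map⁻)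

record Represents {k U} (h : Heap k U) (i : Interp k U) : Set where
  field
    ∈cells⇔ : ∀ {x vs} → (x , vs) ∈ cells h ⇔ Cell i x vs

module _ {k U} {h : Heap k U} {i : Interp k U} (rep : Represents h i) where
  open Represents rep

  ∈dom⇔Allocated : ∀ {x} → x ∈ dom h ⇔ Allocated i x
  ∈dom⇔Allocated = mk⇔ allocated (λ (vs , c) → ∈-map⁺ proj₁ (from ∈cells⇔ c))
    where
    allocated : ∀ {x} → x ∈ dom h → Allocated i x
    allocated x∈ with ∈-map⁻ proj₁ x∈
    ... | (_ , vs) , c∈ , refl = vs , to ∈cells⇔ c∈

  ↪-exact : ∀ s x ys → sat s h (x ↪ ys) ⇔ satFO s i (τ (x ↪ ys))
  ↪-exact s x ys = ⇔.trans ∈cells⇔ (⇔.sym (sat-𝔭⇔ i s (var x) ys refl refl))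

  alloc-exact : ∀ s x → sat s h (alloc x) ⇔ satFO s i (τ (alloc x))
  alloc-exact s x = ⇔.trans (sat-alloc⇔ h s x) (⇔.trans ∈dom⇔Allocated (⇔.sym (sat-τ-alloc⇔ i s x)))

  allocated⇒length≤domSize : ∀ {xs} → Unique xs → All (Allocated i) xs → length xs ≤ domSize h
  allocated⇒length≤domSize unique allocated =
    ≤-trans (Unique-⊆⇒length≤ _≟ᴸ_ unique (from ∈dom⇔Allocated ∘ All.lookup allocated))
            (≤-reflexive (length-dom h))

  covered⇒domSize≤length : ∀ {xs} → (∀ {x vs} → Cell i x vs → x ∈ xs) → domSize h ≤ length xs
  covered⇒domSize≤length covers =
    ≤-trans (≤-reflexive (sym (length-dom h)))
            (Unique-⊆⇒length≤ _≟ᴸ_ (dom-unique h) (covers ∘ proj₂ ∘ to ∈dom⇔Allocated))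

-- From a heap to an interpretation

sizeFlag : Universe → ℕ → Bool
sizeFlag (finU m) = Enumeration.flag (allFin (suc m)) Fin.zero
sizeFlag infU     = λ _ → true

sizeEntry : ∀ U → ℕ → Loc U
sizeEntry (finU m) = Enumeration.entry (allFin (suc m)) Fin.zero
sizeEntry infU     = id

freeFlag : ∀ U → List (Loc U) → ℕ → Bool
freeFlag (finU m) xs = Enumeration.flag (complement xs) Fin.zero
freeFlag infU     _  = λ _ → true

freeEntry : ∀ U → List (Loc U) → ℕ → Loc U
freeEntry (finU m) xs     = Enumeration.entry (complement xs) Fin.zero
freeEntry infU     xs j = suc (max 0 xs) + j

canonical : ∀ {k U} → Heap k U → Interp k U
canonical {k} {U} h = record
  { p = λ x vs → does (DecMembership._∈?_ _≟ᶜ_ (x , vs) (cells h))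
  ; a = λ n → does (n ≤? domSize h)
  ; u = proj₁ ∘ entry
  ; b = sizeFlag U
  ; v = sizeEntry U
  ; c = freeFlag U (dom h)
  ; w = freeEntry U (dom h)
  }
  where open Enumeration (cells h) (loc₀ U , replicate k (loc₀ U))

canonical-represents : ∀ {k U} (h : Heap k U) → Represents h (canonical h)
canonical-represents h = record
  { ∈cells⇔ = λ {x} {vs} → ⇔.sym (does⇔ (DecMembership._∈?_ _≟ᶜ_ (x , vs) (cells h))) }

canonical-AxA : ∀ {k U} (h : Heap k U) m → ⟦AxA⟧ (canonical h) m
canonical-AxA {k} {U} h m =
    (proj₂ (entry (suc m)) , λ a+ →
       flag-pred {m} a+ , to ∈cells⇔ (entry-∈ {m} a+) , entry-AllPairs (functional h) {m} a+)
  , λ x vs ¬a cell → let j , j<m , eq = entry-covers ¬a (from ∈cells⇔ cell) in j , j<m , cong proj₁ eq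
  where
  open Enumeration (cells h) (loc₀ U , replicate k (loc₀ U))
  open Represents (canonical-represents h)

canonical-AxB : ∀ {k} U (h : Heap k U) m → ⟦AxB⟧ (canonical h) m
canonical-AxB (finU n) h m =
    (λ b+ → flag-pred {m} b+ , entry-AllPairs (Uniqueₚ.allFin⁺ (suc n)) {m} b+)
  , λ x ¬b → entry-covers ¬b (∈-allFin x)
  where open Enumeration (allFin (suc n)) Fin.zero
canonical-AxB infU h m = (λ _ → refl , λ j<m → <⇒≢ j<m ∘ suc-injective) , λ x ¬b → ⊥-elim (¬b refl)

canonical-AxC : ∀ {k} U (h : Heap k U) m → ⟦AxC⟧ (canonical h) m
canonical-AxC (finU n) h m vs c+ =
    flag-pred {m} c+
  , (λ cell → ∈complement⇒∉ (dom h) (entry-∈ {m} c+) (from (∈dom⇔Allocated (canonical-represents h)) (vs , cell)))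
  , λ j<m → ≢-sym (entry-AllPairs (complement-unique (dom h)) {m} c+ j<m)
  where open Enumeration (complement (dom h)) Fin.zero
canonical-AxC infU h m vs c+ =
    refl
  , (λ cell → fresh∉ (dom h) (suc m) (from (∈dom⇔Allocated (canonical-represents h)) (vs , cell)))
  , λ j<m → <⇒≢ j<m ∘ suc-injective ∘ sym ∘ +-cancelˡ-≡ (suc (max 0 (dom h))) _ _

sizeFlag-zero : ∀ U → sizeFlag U 0 ≡ true
sizeFlag-zero (finU m) = refl
sizeFlag-zero infU     = refl

freeFlag-zero : ∀ U (xs : List (Loc U)) → freeFlag U xs 0 ≡ true
freeFlag-zero (finU m) xs = refl
freeFlag-zero infU     xs = refl

canonical-axioms : ∀ {k U} (h : Heap k U) N → AxiomsUpTo (canonical h) N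
canonical-axioms {U = U} h N = record
  { p-functional = λ c c′ → keys-distinct⇒functional (functional h) (from ∈cells⇔ c) (from ∈cells⇔ c′)
  ; a-zero = refl
  ; a-step = λ {m} _ → canonical-AxA h m
  ; b-zero = sizeFlag-zero U
  ; b-step = λ {m} _ → canonical-AxB U h m
  ; c-zero = freeFlag-zero U (dom h)
  ; c-step = λ {m} _ → canonical-AxC U h m
  }
  where open Represents (canonical-represents h)

size-flag⇔ : ∀ U {n} → sizeFlag U n ≡ true ⇔ fin n ≤∞ card U
size-flag⇔ (finU m) {n} =
  ⇔.trans flag⇔ (mk⇔ (subst (n ≤_) (length-allFin (suc m))) (subst (n ≤_) (sym (length-allFin (suc m)))))
  where open Enumeration (allFin (suc m)) Fin.zero
size-flag⇔ infU = mk⇔ (λ _ → tt) (λ _ → refl)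

free-flag⇔ : ∀ {k} U (h : Heap k U) n →
             (card U ∸∞ n) ≤∞ fin (domSize h) ⇔ (¬ freeFlag U (dom h) (suc n) ≡ true)
free-flag⇔ (finU m) h n = mk⇔
  (λ hyp c+ → hGeU-refuted free (dom h) unique (to (flag⇔ {suc n}) c+) (resize (sym (length-dom h)) hyp))
  (λ ¬c → resize (length-dom h) (hGeU-covered free (dom h) covers (≮⇒≥ (¬c ∘ from (flag⇔ {suc n})))))
  where
  free = complement (dom h)
  open Enumeration free Fin.zero
  unique = complement-++-unique (dom h) (dom-unique h)
  covers = complement-++-covers (dom h)
  resize = subst (λ d → (card (finU m) ∸∞ n) ≤∞ fin d)
free-flag⇔ infU h n = mk⇔ (λ ()) (λ ¬c → ⊥-elim (¬c refl))

canonical-exact : ∀ {k U} (h : Heap k U) φ s → sat s h φ ⇔ satFO s (canonical h) (τ φ)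
canonical-exact h (x ≈ y)       s = ⇔.refl
canonical-exact h (x ↪ ys)      s = ↪-exact (canonical-represents h) s x ys
canonical-exact h (alloc x)     s = alloc-exact (canonical-represents h) s x
canonical-exact h (hGe (fin n)) s = ⇔.sym (does⇔ (n ≤? domSize h))
canonical-exact h (hGe ∞)       s = mk⇔ (λ ()) (λ f → f tt)
canonical-exact {U = U} h (uGe n)  s = ⇔.sym (size-flag⇔ U)
canonical-exact {U = U} h (hGeU n) s = free-flag⇔ U h n
canonical-exact h (and φ ψ)     s = canonical-exact h φ s ×-⇔ canonical-exact h ψ s
canonical-exact h (neg φ)       s = ¬-cong-⇔ (canonical-exact h φ s)
canonical-exact h (ex x φ)      s = Σ-congˡ (canonical-exact h φ _)

-- From an interpretation to a heap

module Realisation {k U} (i : Interp k U) (finite : FinitelyTrue i) (functional-p : Functional i) where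

  cell? : ∀ (c : Loc U × Vec (Loc U) k) → Dec (Cell i (proj₁ c) (proj₂ c))
  cell? (x , vs) = p i x vs Boolₚ.≟ true

  graph : List (Loc U × Vec (Loc U) k)
  graph = deduplicate _≟ᶜ_ (filter cell? (proj₁ finite))

  ∈graph⇔ : ∀ {x vs} → (x , vs) ∈ graph ⇔ Cell i x vs
  ∈graph⇔ = mk⇔
    (λ c∈ → proj₂ (∈-filter⁻ cell? {xs = proj₁ finite} (∈-deduplicate⁻ _≟ᶜ_ _ c∈)))
    (λ c → ∈-deduplicate⁺ _≟ᶜ_ (∈-filter⁺ cell? (proj₂ finite _ _ c) c))

  heap : Heap k U
  heap = record
    { cells = graph
    ; functional = AllPairs-mapWithAll keys-differ (All.tabulate (to ∈graph⇔)) (DecUniqueₚ.deduplicate-! _≟ᶜ_ _)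
    }
    where
    keys-differ : ∀ {c d} → Cell i (proj₁ c) (proj₂ c) → Cell i (proj₁ d) (proj₂ d) → c ≢ d → proj₁ c ≢ proj₁ d
    keys-differ c d c≢d refl = c≢d (cong (_ ,_) (functional-p c d))

  represents : Represents heap i
  represents = record { ∈cells⇔ = ∈graph⇔ }

module _ {k U} (h : Heap k U) (i : Interp k U) where

  Transfers : Pol → QBC k → Store U → Set
  Transfers pos  φ s = satFO s i (τ φ) → sat s h φ
  Transfers negv φ s = sat s h φ → satFO s i (τ φ)

  exact⇒transfers : ∀ q {φ s} → sat s h φ ⇔ satFO s i (τ φ) → Transfers q φ s
  exact⇒transfers pos  exact = from exact
  exact⇒transfers negv exact = to exact

module _ {k U} {i : Interp k U} {N} (ax : AxiomsUpTo i N) {h : Heap k U} (rep : Represents h i) where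
  open AxiomsUpTo ax

  a-exact : ∀ {n} → n ≤ N → a i n ≡ true ⇔ n ≤ domSize h
  a-exact {n} n≤N = mk⇔ sound (complete n n≤N)
    where
    sound : a i n ≡ true → n ≤ domSize h
    sound an = subst (_≤ domSize h) (Listₚ.length-applyDownFrom (u i ∘ suc) n)
                 (allocated⇒length≤domSize rep unique allocated)
      where
      step : ∀ {m} → m < n → a i (suc m) ≡ true →
             a i m ≡ true × Allocated i (u i (suc m)) × (∀ {j} → j < m → u i (suc j) ≢ u i (suc m))
      step m<n a+ = let (vs , up) , _ = a-step (<-≤-trans m<n n≤N) ; am , cell , distinct = up a+
                    in am , (vs , cell) , distinct
      unique,allocated = chain {P = λ m → a i m ≡ true} {Q = Allocated i} (u i) n step an
      unique = proj₁ unique,allocated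
      allocated = proj₂ unique,allocated
    complete : ∀ n → n ≤ N → n ≤ domSize h → a i n ≡ true
    complete zero    _   _   = a-zero
    complete (suc m) m<N m<h = decidable-stable (a i (suc m) Boolₚ.≟ true) λ ¬a+ →
      <⇒≱ m<h (subst (domSize h ≤_) (Listₚ.length-applyDownFrom (u i ∘ suc) m) (covered⇒domSize≤length rep λ c →
        ∈-applyDownFrom-suc⁺ (u i) (proj₂ (a-step m<N) _ _ ¬a+ c)))

  b-exact : ∀ {n} → n ≤ N → b i n ≡ true ⇔ fin n ≤∞ card U
  b-exact {n} n≤N = mk⇔ sound (complete n n≤N)
    where
    sound : b i n ≡ true → fin n ≤∞ card U
    sound bn = subst (λ l → fin l ≤∞ card U) (Listₚ.length-applyDownFrom (v i ∘ suc) n) (length≤card unique)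
      where
      step : ∀ {m} → m < n → b i (suc m) ≡ true →
             b i m ≡ true × ⊤ × (∀ {j} → j < m → v i (suc j) ≢ v i (suc m))
      step m<n b+ = let bm , distinct = proj₁ (b-step (<-≤-trans m<n n≤N)) b+ in bm , tt , distinct
      unique = proj₁ (chain {P = λ m → b i m ≡ true} {Q = λ _ → ⊤} (v i) n step bn)
    complete : ∀ n → n ≤ N → fin n ≤∞ card U → b i n ≡ true
    complete zero    _   _   = b-zero
    complete (suc m) m<N m<U = decidable-stable (b i (suc m) Boolₚ.≟ true) λ ¬b+ →
      <-irrefl refl (≤∞-trans m<U (subst (λ l → card U ≤∞ fin l) (Listₚ.length-applyDownFrom (v i ∘ suc) m)
        (card≤length λ x → ∈-applyDownFrom-suc⁺ (v i) (proj₂ (b-step m<N) x ¬b+))))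

  c-refutes-hGeU : ∀ {n} → n ≤ N → c i (suc n) ≡ true → ¬ (card U ∸∞ n) ≤∞ fin (domSize h)
  c-refutes-hGeU {n} n≤N c+ hyp =
    hGeU-refuted ws (dom h) (Uniqueₚ.++⁺ unique (dom-unique h) disjoint) (≤-reflexive (sym length-ws))
      (subst (λ l → (card U ∸∞ n) ≤∞ fin l) (sym (length-dom h)) hyp)
    where
    ws = applyDownFrom (w i ∘ suc) (suc n)
    length-ws = Listₚ.length-applyDownFrom (w i ∘ suc) (suc n)
    step : ∀ {m} → m < suc n → c i (suc m) ≡ true →
           c i m ≡ true × (¬ Allocated i (w i (suc m))) × (∀ {j} → j < m → w i (suc j) ≢ w i (suc m))
    step m<n c+ = let cm , _ , distinct = C (replicate k (loc₀ U)) c+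
                  in cm , (λ (vs , cell) → proj₁ (proj₂ (C vs c+)) cell) , ≢-sym ∘ distinct
      where C = c-step (≤-trans m<n (s≤s n≤N))
    unique,unallocated = chain {P = λ m → c i m ≡ true} {Q = ¬_ ∘ Allocated i} (w i) (suc n) step c+
    unique = proj₁ unique,unallocated
    unallocated = proj₂ unique,unallocated
    disjoint : ∀ {x} → x ∈ ws × x ∈ dom h → ⊥
    disjoint (x∈ws , x∈dom) = All.lookup unallocated x∈ws (to (∈dom⇔Allocated rep) x∈dom)

  transfer : ∀ q φ → maxParam φ ≤ N → HGeUAt q φ → ∀ s → Transfers h i q φ s
  transfer q    (x ≈ y)       _  _  s = exact⇒transfers h i q ⇔.refl
  transfer q    (x ↪ ys)      _  _  s = exact⇒transfers h i q (↪-exact rep s x ys)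
  transfer q    (alloc x)     _  _  s = exact⇒transfers h i q (alloc-exact rep s x)
  transfer q    (hGe (fin n)) le _  s = exact⇒transfers h i q (⇔.sym (a-exact le))
  transfer q    (hGe ∞)       _  _  s = exact⇒transfers h i q (mk⇔ (λ ()) (λ f → f tt))
  transfer q    (uGe n)       le _  s = exact⇒transfers h i q (⇔.sym (b-exact le))
  transfer negv (hGeU n)      le _  s = λ hyp c+ → c-refutes-hGeU le c+ hyp
  transfer pos  (and φ ψ)     le (hφ , hψ) s (t , t′) =
    transfer pos φ (m⊔n≤o⇒m≤o _ _ le) hφ s t , transfer pos ψ (m⊔n≤o⇒n≤o _ _ le) hψ s t′
  transfer negv (and φ ψ)     le (hφ , hψ) s (t , t′) =
    transfer negv φ (m⊔n≤o⇒m≤o _ _ le) hφ s t , transfer negv ψ (m⊔n≤o⇒n≤o _ _ le) hψ s t′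
  transfer pos  (neg φ)       le hφ s ¬t = ¬t ∘ transfer negv φ le hφ s
  transfer negv (neg φ)       le hφ s ¬t = ¬t ∘ transfer pos φ le hφ s
  transfer pos  (ex x φ)      le hφ s (ℓ , t) = ℓ , transfer pos φ le hφ (s [ x ↦ ℓ ]) t
  transfer negv (ex x φ)      le hφ s (ℓ , t) = ℓ , transfer negv φ le hφ (s [ x ↦ ℓ ]) t

lemma1 : (k : ℕ) → 1 ≤ k → (φ : QBC k) (U : Universe) (s : Store U) →
           ((Σ (Heap k U) λ h → sat s h φ) →
              Σ (Interp k U) λ i → satFO s i (andF (τ φ) (Ax φ)))
           ×
           (HGeUNegOnly φ → (i : Interp k U) → FinitelyTrue i →
              satFO s i (andF (τ φ) (Ax φ)) →
              Σ (Heap k U) λ h → sat s h φ)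
lemma1 k _ φ U s =
    (λ (h , sat-φ) →
       canonical h , to (canonical-exact h φ s) sat-φ , from (sat-Ax⇔ (canonical h) s φ) (canonical-axioms h _))
  , λ negative i finite (τφ , sat-Ax) →
      let axioms = to (sat-Ax⇔ i s φ) sat-Ax
          open Realisation i finite (AxiomsUpTo.p-functional axioms)
      in heap , transfer axioms represents pos φ ≤-refl negative s τφ
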